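{- Let $n$ and $a$ be relatively prime positive integers and $s\ge1$, and assume the Euclidean algorithm with $n$ and $a$ (in the generalized sense described in the context) produces the symmetric sequence of quotients $q_1,\ldots,q_s,q_s,\ldots,q_1$ (of length $2s$), with remainders $r_1=n, r_2=a, r_3,\ldots, r_{2s+1}=1, r_{2s+2}=0$. Let $\mathfrak{c}_{i,j}$ be the continuants of the sequence $(q_1,\ldots,q_s)$. Then for $1\le i\le s+1$, $$r_i=\mathfrak{c}_{1,s}\mathfrak{c}_{i,s}+\mathfrak{c}_{1,s-1}\mathfrak{c}_{i,s-1}$$ and $$r_{2s-i+3}=\mathfrak{c}_{1,i-2}=(-1)^{i+s}\left(\mathfrak{c}_{1,s}\mathfrak{c}_{i,s-1}-\mathfrak{c}_{1,s-1}\mathfrak{c}_{i,s}\right).$$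
   Context: Generalized Euclidean algorithm: for a finite sequence $(u_1,\ldots,u_m)$ of positive integers, the remainders are $\rho_1,\ldots,\rho_{m+2}$ defined by $\rho_{m+2}=0$, $\rho_{m+1}=1$, $\rho_k=u_k\rho_{k+1}+\rho_{k+2}$ for $1\le k\le m$; we say the Euclidean algorithm with $n=\rho_1$ and $a=\rho_2$ produces the quotients $(u_1,\ldots,u_m)$ and remainders $\rho_1,\ldots,\rho_{m+2}$. This is the ordinary Euclidean algorithm except that the last quotient is allowed to equal $1$ (convention: an ordinary final step $r_l=q_l\cdot1+0$ may be rewritten as $r_l=(q_l-1)\cdot1+1$, $1=1\cdot1+0$). Here the quotient sequence is $u_k=q_k$ and $u_{2s+1-k}=q_k$ for $1\le k\le s$. Continuants: for a sequence $(u_1,\ldots,u_t)$ of positive integers and $1\le i\le j\le t$, $\mathfrak{c}_{i,j}$ is the determinant of the tridiagonal matrix with diagonal entries $u_i,\ldots,u_j$, superdiagonal entries $1$ and subdiagonal entries $-1$; also $\mathfrak{c}_{j+1,j}=1$ for $0\le j\le t$ and $\mathfrak{c}_{j+2,j}=0$ for $-1\le j\le t$. -}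

module Defs where

open import Data.Nat as ℕ using (ℕ; zero; suc)
open import Data.Fin using (Fin; zero; suc; toℕ; punchIn)
open import Data.Integer using (ℤ; +_; -[1+_]; _+_; _*_; _-_; _^_; -1ℤ; 0ℤ; 1ℤ)
open import Relation.Nullary using (yes; no)

sumFin : (n : ℕ) → (Fin n → ℤ) → ℤ
sumFin zero    f = 0ℤ
sumFin (suc n) f = f zero + sumFin n (λ k → f (suc k))

det : (n : ℕ) → (Fin n → Fin n → ℤ) → ℤ
det zero    M = 1ℤ
det (suc n) M =
  sumFin (suc n) (λ j → (-1ℤ ^ toℕ j) * M zero j * det n (λ k l → M (suc k) (punchIn j l)))

-- The n×n tridiagonal matrix with diagonal entries u i, u (i+1), …, u (i+n-1),
-- superdiagonal entries 1 and subdiagonal entries -1 (1-based sequence u).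
tridiag : (u : ℕ → ℕ) (i n : ℕ) → Fin n → Fin n → ℤ
tridiag u i n k l with toℕ k ℕ.≟ toℕ l | suc (toℕ k) ℕ.≟ toℕ l | toℕ k ℕ.≟ suc (toℕ l)
... | yes _ | _     | _     = + u (i ℕ.+ toℕ k)
... | no _  | yes _ | _     = 1ℤ
... | no _  | no _  | yes _ = -1ℤ
... | no _  | no _  | no _  = 0ℤ

-- Continuant 𝔠_{i,j} of the sequence u (1-based), with j an integer:
--  * for i ≤ j: determinant of the tridiagonal matrix with diagonal u_i,…,u_j;
--  * 𝔠_{j+1,j} = 1 (the empty determinant);
--  * 𝔠_{j+2,j} = 0;
--  * other values (j < i-2) are not used by the paper; set to 0.
cont : (u : ℕ → ℕ) → ℕ → ℤ → ℤ
cont u i j with j - + i + 1ℤ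
... | + n        = det n (tridiag u i n)
... | -[1+ _ ]   = 0ℤ

-- The proof rests
-- on one principle: solutions of the backward three-term recursion f x = c_x f(x+1) + f(x+2)
-- are determined by two consecutive values (Recursions.solution-unique).
--   * Determinants, Continuants: Laplace expansion of the tridiagonal determinant gives the
--     recursion 𝔠_{i,j} = q_i 𝔠_{i+1,j} + 𝔠_{i+2,j}; by induction also 𝔠_{i,j} = q_j 𝔠_{i,j-1} + 𝔠_{i,j-2},
--     together with the boundary values 𝔠_{i+1,i} = 1 and 𝔠_{i+2,i} = 0.
--   * ContinuantIdentities: x ↦ A 𝔠_{x,s} + B 𝔠_{x,s-1} solves the recursion, so every solution is
--     of this form with A = f(s+1), B = f(s+2); and x ↦ (-1)^x 𝔠_{1,x-2} solves it too, which
--     yields the alternating identity for 𝔠_{1,i-2}.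
--   * SymmetricEuclid: the remainders solve the recursion with coefficients u.  On the second half
--     u is q reversed, so r_x = 𝔠_{1,2s+1-x} there (both sides agree at 2s+1, 2s+2); in particular
--     r_{s+1} = 𝔠_{1,s} and r_{s+2} = 𝔠_{1,s-1}, and the first half follows from the general form.
--     (IndexArithmetic handles the integer indices such as 2s+1-x.)
-- The theorem collects the three identities.
module Submission where

module Determinants where

  open import Defs
  open import Data.Nat using (zero; suc)
  open import Data.Fin using (Fin; zero; suc; toℕ; punchIn; punchOut)
  open import Data.Fin.Properties using (punchIn-punchOut) renaming (_≟_ to _≟ᶠ_)
  open import Data.Integer using (ℤ; _+_; _*_; _^_; -1ℤ; 0ℤ)
  open import Data.Integer.Properties using (*-zeroˡ; *-zeroʳ)
  open import Relation.Nullary using (yes; no)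
  open import Relation.Binary.PropositionalEquality

  minor : ∀ {n} → Fin (suc n) → (Fin (suc n) → Fin (suc n) → ℤ) → Fin n → Fin n → ℤ
  minor j M k l = M (suc k) (punchIn j l)

  sumFin-cong : ∀ n {f g : Fin n → ℤ} → (∀ k → f k ≡ g k) → sumFin n f ≡ sumFin n g
  sumFin-cong zero    f≗g = refl
  sumFin-cong (suc n) f≗g = cong₂ _+_ (f≗g zero) (sumFin-cong n (λ k → f≗g (suc k)))

  sumFin-zero : ∀ n {f : Fin n → ℤ} → (∀ k → f k ≡ 0ℤ) → sumFin n f ≡ 0ℤ
  sumFin-zero zero    f≗0 = refl
  sumFin-zero (suc n) f≗0 = cong₂ _+_ (f≗0 zero) (sumFin-zero n (λ k → f≗0 (suc k)))

  det-cong : ∀ n {M N : Fin n → Fin n → ℤ} → (∀ k l → M k l ≡ N k l) → det n M ≡ det n N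
  det-cong zero    M≗N = refl
  det-cong (suc n) M≗N = sumFin-cong (suc n) λ j →
    cong₂ (λ a d → (-1ℤ ^ toℕ j) * a * d) (M≗N zero j) (det-cong n (λ k l → M≗N (suc k) (punchIn j l)))

  zeroEntry-term : ∀ (σ d : ℤ) → σ * 0ℤ * d ≡ 0ℤ
  zeroEntry-term σ d = trans (cong (_* d) (*-zeroʳ σ)) (*-zeroˡ d)

  -- A matrix with a zero column has determinant zero: expanding along the first row, the term
  -- of column c vanishes by its entry, every other term by induction on its minor.
  det-zeroColumn : ∀ n (M : Fin n → Fin n → ℤ) c → (∀ k → M k c ≡ 0ℤ) → det n M ≡ 0ℤ
  det-zeroColumn (suc n) M c col≡0 = sumFin-zero (suc n) term
    where
    term : ∀ j → (-1ℤ ^ toℕ j) * M zero j * det n (minor j M) ≡ 0ℤ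
    term j with j ≟ᶠ c
    ... | yes refl = trans (cong (λ a → (-1ℤ ^ toℕ j) * a * det n (minor j M)) (col≡0 zero))
                           (zeroEntry-term (-1ℤ ^ toℕ j) (det n (minor j M)))
    ... | no j≢c   = trans (cong ((-1ℤ ^ toℕ j) * M zero j *_)
                                 (det-zeroColumn n (minor j M) (punchOut j≢c) minorColumn≡0))
                           (*-zeroʳ ((-1ℤ ^ toℕ j) * M zero j))
      where
      minorColumn≡0 : ∀ k → minor j M k (punchOut j≢c) ≡ 0ℤ
      minorColumn≡0 k = trans (cong (M (suc k)) (punchIn-punchOut j≢c)) (col≡0 (suc k))

module Continuants where

  open import Defs
  open import Data.Nat as ℕ using (ℕ; zero; suc; 2+)
  open import Data.Nat.Properties using (+-suc; +-identityʳ)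
  open import Data.Fin using (Fin; zero; suc; toℕ)
  open import Data.Integer using (ℤ; +_; -[1+_]; _+_; _*_; _-_; -_; _^_; -1ℤ; 0ℤ; 1ℤ)
  open import Data.Integer.Properties using (*-zeroʳ; +-injective)
  open import Data.Integer.Tactic.RingSolver using (solve-∀)
  open import Data.Nat.Tactic.RingSolver using () renaming (solve-∀ to ℕ-solve-∀)
  open import Relation.Nullary using (yes; no)
  open import Relation.Nullary.Decidable using (T?)
  open import Relation.Binary.PropositionalEquality
  open ≡-Reasoning
  open Determinants

  -- Deleting the first row and column of a tridiagonal matrix leaves the tridiagonal matrix
  -- of the shifted sequence.  (The entries of tridiag are decided by comparisons of toℕ k and
  -- toℕ l, which are the same comparisons for suc k and suc l.)
  tridiag-shift : ∀ u i n (k l : Fin n) → tridiag u i (suc n) (suc k) (suc l) ≡ tridiag u (suc i) n k l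
  tridiag-shift u i n k l
    with T? (toℕ k ℕ.≡ᵇ toℕ l) | T? (suc (toℕ k) ℕ.≡ᵇ toℕ l) | T? (toℕ k ℕ.≡ᵇ suc (toℕ l))
  ... | yes _ | _     | _     = cong (λ m → + u m) (+-suc i (toℕ k))
  ... | no _  | yes _ | _     = refl
  ... | no _  | no _  | yes _ = refl
  ... | no _  | no _  | no _  = refl

  -- κ u i n is the continuant of the n ∸ 1 terms u i, …, u (i + n ∸ 2), i.e. the paper's
  -- 𝔠_{i,i+n-2}; the shift makes κ u i 0 = 𝔠_{i,i-2} = 0 and κ u i 1 = 𝔠_{i,i-1} = 1, so that a
  -- single three-term recursion (expansion at the left end) defines it.
  κ : (ℕ → ℕ) → ℕ → ℕ → ℤ
  κ u i zero                = 0ℤ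
  κ u i (suc zero)          = 1ℤ
  κ u i (suc (suc n))       = + u i * κ u (suc i) (suc n) + κ u (suc (suc i)) n

  -- The minor of the tridiagonal matrix for column 1 has first row (-1, 1, 0, …, 0); its first
  -- column vanishes below, so only the -1 contributes, with the minor of the shifted sequence.
  det-tridiag-minor₁ : ∀ u i m →
    det (suc m) (minor (suc zero) (tridiag u i (suc (suc m)))) ≡ - det m (tridiag u (suc (suc i)) m)
  det-tridiag-minor₁ u i m = begin
    1ℤ * -1ℤ * det m (minor zero N) + sumFin m tailTerm
      ≡⟨ cong₂ (λ d t → 1ℤ * -1ℤ * d + t) shifted (sumFin-zero m tailTerm≡0) ⟩
    1ℤ * -1ℤ * D + 0ℤ
      ≡⟨ negate D ⟩
    - D ∎
    where
    N = minor (suc zero) (tridiag u i (suc (suc m)))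
    D = det m (tridiag u (suc (suc i)) m)
    tailTerm : Fin m → ℤ
    tailTerm j = (-1ℤ ^ toℕ (suc j)) * N zero (suc j) * det m (minor (suc j) N)
    shifted : det m (minor zero N) ≡ D
    shifted = det-cong m λ k l → trans (tridiag-shift u i (suc m) (suc k) (suc l)) (tridiag-shift u (suc i) m k l)
    tailTerm≡0 : ∀ j → tailTerm j ≡ 0ℤ
    tailTerm≡0 zero    = trans (cong (-1ℤ * N zero (suc zero) *_)
                                     (det-zeroColumn m (minor (suc zero) N) zero (λ k → refl)))
                                (*-zeroʳ (-1ℤ * N zero (suc zero)))
    tailTerm≡0 (suc j) = zeroEntry-term (-1ℤ ^ toℕ (suc (suc j))) (det m (minor (suc (suc j)) N))
    negate : ∀ d → 1ℤ * -1ℤ * d + 0ℤ ≡ - d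
    negate = solve-∀

  -- The tridiagonal determinant is the continuant: Laplace expansion along the first row
  -- (u i, 1, 0, …, 0) gives u i times the shifted determinant plus the column-1 minor.
  det-tridiag : ∀ u i m → det m (tridiag u i m) ≡ κ u i (suc m)
  det-tridiag u i zero          = refl
  det-tridiag u i (suc zero)    = begin
    1ℤ * + u (i ℕ.+ 0) * 1ℤ + 0ℤ  ≡⟨ cong (λ k → 1ℤ * + u k * 1ℤ + 0ℤ) (+-identityʳ i) ⟩
    1ℤ * + u i * 1ℤ + 0ℤ          ≡⟨ unit (+ u i) ⟩
    + u i * 1ℤ + 0ℤ               ∎
    where
    unit : ∀ a → 1ℤ * a * 1ℤ + 0ℤ ≡ a * 1ℤ + 0ℤ
    unit = solve-∀
  det-tridiag u i (suc (suc m)) = begin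
    1ℤ * + u (i ℕ.+ 0) * det (suc m) (minor zero T)
      + (-1ℤ * 1ℤ * det (suc m) (minor (suc zero) T) + sumFin m tailTerm)
      ≡⟨ cong₂ (λ k d → 1ℤ * + u k * d + (-1ℤ * 1ℤ * det (suc m) (minor (suc zero) T) + sumFin m tailTerm))
               (+-identityʳ i) (det-cong (suc m) (tridiag-shift u i (suc m))) ⟩
    1ℤ * + u i * det (suc m) (tridiag u (suc i) (suc m))
      + (-1ℤ * 1ℤ * det (suc m) (minor (suc zero) T) + sumFin m tailTerm)
      ≡⟨ cong₂ (λ d e → 1ℤ * + u i * d + (-1ℤ * 1ℤ * e + sumFin m tailTerm))
               (det-tridiag u (suc i) (suc m))
               (trans (det-tridiag-minor₁ u i m) (cong -_ (det-tridiag u (suc (suc i)) m))) ⟩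
    1ℤ * + u i * κ u (suc i) (suc (suc m)) + (-1ℤ * 1ℤ * - κ u (suc (suc i)) (suc m) + sumFin m tailTerm)
      ≡⟨ cong (λ t → 1ℤ * + u i * κ u (suc i) (suc (suc m)) + (-1ℤ * 1ℤ * - κ u (suc (suc i)) (suc m) + t))
              (sumFin-zero m tailTerm≡0) ⟩
    1ℤ * + u i * κ u (suc i) (suc (suc m)) + (-1ℤ * 1ℤ * - κ u (suc (suc i)) (suc m) + 0ℤ)
      ≡⟨ simplify (+ u i) (κ u (suc i) (suc (suc m))) (κ u (suc (suc i)) (suc m)) ⟩
    + u i * κ u (suc i) (suc (suc m)) + κ u (suc (suc i)) (suc m)
      ∎
    where
    T = tridiag u i (suc (suc m))
    tailTerm : Fin m → ℤ
    tailTerm j = (-1ℤ ^ toℕ (suc (suc j))) * T zero (suc (suc j)) * det (suc m) (minor (suc (suc j)) T)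
    tailTerm≡0 : ∀ j → tailTerm j ≡ 0ℤ
    tailTerm≡0 j = zeroEntry-term (-1ℤ ^ toℕ (suc (suc j))) (det (suc m) (minor (suc (suc j)) T))
    simplify : ∀ a b c → 1ℤ * a * b + (-1ℤ * 1ℤ * - c + 0ℤ) ≡ a * b + c
    simplify = solve-∀

  -- Continuants can equally be expanded at the right end (induction on the length, using the
  -- left-end expansion on both sides).
  κ-expandʳ : ∀ u i n → κ u i (suc (suc n)) ≡ + u (i ℕ.+ n) * κ u i (suc n) + κ u i n
  κ-expandʳ u i zero          = cong (λ k → + u k * 1ℤ + 0ℤ) (sym (+-identityʳ i))
  κ-expandʳ u i (suc zero)    = begin
    + u i * (+ u (suc i) * 1ℤ + 0ℤ) + 1ℤ  ≡⟨ swap (+ u i) (+ u (suc i)) ⟩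
    + u (suc i) * (+ u i * 1ℤ + 0ℤ) + 1ℤ  ≡⟨ cong (λ k → + u k * (+ u i * 1ℤ + 0ℤ) + 1ℤ) (sym i+1≡1+i) ⟩
    + u (i ℕ.+ 1) * (+ u i * 1ℤ + 0ℤ) + 1ℤ ∎
    where
    i+1≡1+i : i ℕ.+ 1 ≡ suc i
    i+1≡1+i = trans (+-suc i 0) (cong suc (+-identityʳ i))
    swap : ∀ a b → a * (b * 1ℤ + 0ℤ) + 1ℤ ≡ b * (a * 1ℤ + 0ℤ) + 1ℤ
    swap = solve-∀
  κ-expandʳ u i (suc (suc n)) = begin
    + u i * κ u (suc i) (suc (2+ n)) + κ u (2+ i) (2+ n)
      ≡⟨ cong₂ (λ a b → + u i * a + b) (κ-expandʳ u (suc i) (suc n)) (κ-expandʳ u (suc (suc i)) n) ⟩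
    + u i * (+ u (suc i ℕ.+ suc n) * κ u (suc i) (2+ n) + κ u (suc i) (suc n))
      + (+ u (2+ i ℕ.+ n) * κ u (2+ i) (suc n) + κ u (2+ i) n)
      ≡⟨ cong₂ (λ k l → + u i * (+ u k * κ u (suc i) (2+ n) + κ u (suc i) (suc n))
                         + (+ u l * κ u (2+ i) (suc n) + κ u (2+ i) n))
               (sym (+-suc i (suc n))) (sym (trans (+-suc i (suc n)) (cong suc (+-suc i n)))) ⟩
    + u i * (U * κ u (suc i) (2+ n) + κ u (suc i) (suc n)) + (U * κ u (2+ i) (suc n) + κ u (2+ i) n)
      ≡⟨ regroup (+ u i) U (κ u (suc i) (2+ n)) (κ u (suc i) (suc n)) (κ u (2+ i) (suc n)) (κ u (2+ i) n) ⟩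
    U * (+ u i * κ u (suc i) (2+ n) + κ u (2+ i) (suc n)) + (+ u i * κ u (suc i) (suc n) + κ u (2+ i) n)
      ∎
    where
    U = + u (i ℕ.+ suc (suc n))
    regroup : ∀ a U b c d e → a * (U * b + c) + (U * d + e) ≡ U * (a * b + d) + (a * c + e)
    regroup = solve-∀

  cont-size : ∀ i j n → j + + 2 ≡ + (i ℕ.+ n) → j - + i + 1ℤ ≡ + n - 1ℤ
  cont-size i j n j+2≡i+n = begin
    j - + i + 1ℤ            ≡⟨ rearrange j (+ i) ⟩
    (j + + 2) - + i - 1ℤ    ≡⟨ cong (λ k → k - + i - 1ℤ) j+2≡i+n ⟩
    (+ i + + n) - + i - 1ℤ  ≡⟨ cancel (+ i) (+ n) ⟩
    + n - 1ℤ                ∎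
    where
    rearrange : ∀ j i → j - i + 1ℤ ≡ (j + + 2) - i - 1ℤ
    rearrange = solve-∀
    cancel : ∀ i n → (i + n) - i - 1ℤ ≡ n - 1ℤ
    cancel = solve-∀

  -- The paper's continuant 𝔠_{i,j} (Defs.cont) is κ u i n for the n with j + 2 = i + n; this
  -- covers the genuine determinants (n ≥ 1) as well as the convention 𝔠_{i,i-2} = 0 (n = 0).
  cont≡κ : ∀ u i j n → j + + 2 ≡ + (i ℕ.+ n) → cont u i j ≡ κ u i n
  cont≡κ u i j n j+2≡i+n with j - + i + 1ℤ | cont-size i j n j+2≡i+n
  cont≡κ u i j (suc n) _ | + m      | m≡n = trans (det-tridiag u i m) (cong (κ u i) (cong suc (+-injective m≡n)))
  cont≡κ u i j zero    _ | -[1+ m ] | _   = refl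

  cont-empty : ∀ u i → cont u (suc i) (+ i) ≡ 1ℤ
  cont-empty u i = cont≡κ u (suc i) (+ i) 1 (cong +_ (+-suc i 1))

  cont-vanishing : ∀ u i j → j + + 2 ≡ + i → cont u i j ≡ 0ℤ
  cont-vanishing u i j j+2≡i = cont≡κ u i j 0 (trans j+2≡i (cong +_ (sym (+-identityʳ i))))

  cont-expandˡ : ∀ u i j d → i ℕ.+ d ≡ j → cont u i (+ j) ≡ + u i * cont u (suc i) (+ j) + cont u (2+ i) (+ j)
  cont-expandˡ u i .(i ℕ.+ d) d refl = begin
    cont u i (+ (i ℕ.+ d))
      ≡⟨ cont≡κ u i (+ (i ℕ.+ d)) (2+ d) (cong +_ (length₀ i d)) ⟩
    κ u i (2+ d)
      ≡⟨ cong₂ (λ a b → + u i * a + b) (sym (cont≡κ u (suc i) (+ (i ℕ.+ d)) (suc d) (cong +_ (length₁ i d))))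
                                        (sym (cont≡κ u (2+ i) (+ (i ℕ.+ d)) d (cong +_ (length₂ i d)))) ⟩
    + u i * cont u (suc i) (+ (i ℕ.+ d)) + cont u (2+ i) (+ (i ℕ.+ d))
      ∎
    where
    length₀ : ∀ i d → i ℕ.+ d ℕ.+ 2 ≡ i ℕ.+ 2+ d
    length₀ = ℕ-solve-∀
    length₁ : ∀ i d → i ℕ.+ d ℕ.+ 2 ≡ suc i ℕ.+ suc d
    length₁ = ℕ-solve-∀
    length₂ : ∀ i d → i ℕ.+ d ℕ.+ 2 ≡ 2+ i ℕ.+ d
    length₂ = ℕ-solve-∀

  cont-expandʳ : ∀ u i d → cont u i (+ (i ℕ.+ d)) ≡
    + u (i ℕ.+ d) * cont u i (+ (i ℕ.+ d) - + 1) + cont u i (+ (i ℕ.+ d) - + 2)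
  cont-expandʳ u i d = begin
    cont u i (+ (i ℕ.+ d))
      ≡⟨ cont≡κ u i (+ (i ℕ.+ d)) (2+ d) (cong +_ (length₀ i d)) ⟩
    κ u i (2+ d)
      ≡⟨ κ-expandʳ u i d ⟩
    + u (i ℕ.+ d) * κ u i (suc d) + κ u i d
      ≡⟨ cong₂ (λ a b → + u (i ℕ.+ d) * a + b)
               (sym (cont≡κ u i (+ (i ℕ.+ d) - + 1) (suc d)
                          (trans (minusOne (+ (i ℕ.+ d))) (cong +_ (length₁ i d)))))
               (sym (cont≡κ u i (+ (i ℕ.+ d) - + 2) d (minusTwo (+ (i ℕ.+ d))))) ⟩
    + u (i ℕ.+ d) * cont u i (+ (i ℕ.+ d) - + 1) + cont u i (+ (i ℕ.+ d) - + 2)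
      ∎
    where
    length₀ : ∀ i d → i ℕ.+ d ℕ.+ 2 ≡ i ℕ.+ 2+ d
    length₀ = ℕ-solve-∀
    length₁ : ∀ i d → i ℕ.+ d ℕ.+ 1 ≡ i ℕ.+ suc d
    length₁ = ℕ-solve-∀
    minusOne : ∀ a → (a - + 1) + + 2 ≡ a + + 1
    minusOne = solve-∀
    minusTwo : ∀ a → (a - + 2) + + 2 ≡ a
    minusTwo = solve-∀

module Recursions where

  open import Data.Nat as ℕ using (ℕ; zero; suc; _≤_; _<_; s≤s; z≤n)
  open import Data.Nat.Properties using (suc-injective; +-suc; +-identityʳ; m≤n⇒∃[o]m+o≡n; m<m+n; ≤-trans; n≤1+n)
  open import Data.Integer using (ℤ; _+_; _*_)
  open import Data.Product using (_×_; _,_; proj₁; proj₂)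
  open import Relation.Binary.PropositionalEquality
  open ≡-Reasoning

  Solves : (c f : ℕ → ℤ) (lo m : ℕ) → Set
  Solves c f lo m = ∀ x → lo ≤ x → x < m → f x ≡ c x * f (suc x) + f (suc (suc x))

  -- Two solutions of the same backward recursion on [lo, m) that agree at m and m + 1 agree
  -- on all of [lo, m + 1]: descend from m, carrying agreement at two consecutive points.
  solution-unique : ∀ (c f g : ℕ → ℤ) lo m → Solves c f lo m → Solves c g lo m →
    f m ≡ g m → f (suc m) ≡ g (suc m) → ∀ x → lo ≤ x → x ≤ suc m → f x ≡ g x
  solution-unique c f g lo m f-solves g-solves fm≡gm fm+1≡gm+1 x lo≤x x≤m+1
    with m≤n⇒∃[o]m+o≡n x≤m+1
  ... | zero  , x+0≡m+1 = subst (λ y → f y ≡ g y) (sym (trans (sym (+-identityʳ x)) x+0≡m+1)) fm+1≡gm+1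
  ... | suc d , x+d+1≡m+1 = proj₁ (agreeFrom d x (suc-injective (trans (sym (+-suc x d)) x+d+1≡m+1)) lo≤x)
    where
    agreeFrom : ∀ d x → x ℕ.+ d ≡ m → lo ≤ x → f x ≡ g x × f (suc x) ≡ g (suc x)
    agreeFrom zero    x x+0≡m _ rewrite +-identityʳ x | x+0≡m = fm≡gm , fm+1≡gm+1
    agreeFrom (suc d) x x+d+1≡m lo≤x = fx≡gx , fx+1≡gx+1
      where
      x<m : x < m
      x<m = subst (x <_) x+d+1≡m (m<m+n x (s≤s z≤n))
      further : f (suc x) ≡ g (suc x) × f (suc (suc x)) ≡ g (suc (suc x))
      further = agreeFrom d (suc x) (trans (sym (+-suc x d)) x+d+1≡m) (≤-trans lo≤x (n≤1+n x))
      fx+1≡gx+1 : f (suc x) ≡ g (suc x)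
      fx+1≡gx+1 = proj₁ further
      fx≡gx : f x ≡ g x
      fx≡gx = begin
        f x                                  ≡⟨ f-solves x lo≤x x<m ⟩
        c x * f (suc x) + f (suc (suc x))    ≡⟨ cong₂ (λ a b → c x * a + b) fx+1≡gx+1 (proj₂ further) ⟩
        c x * g (suc x) + g (suc (suc x))    ≡⟨ sym (g-solves x lo≤x x<m) ⟩
        g x                                  ∎

module ContinuantIdentities where

  open import Defs
  open import Data.Nat as ℕ using (ℕ; zero; suc; 2+; _≤_; _<_; s≤s; z≤n)
  open import Data.Nat.Properties using (+-suc; +-comm; +-identityʳ; m≤n⇒∃[o]m+o≡n; <⇒≤; ≤-refl)
  open import Data.Integer using (ℤ; +_; _+_; _*_; _-_; -_; _^_; -1ℤ; 0ℤ; 1ℤ)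
  open import Data.Integer.Properties using (^-distribˡ-+-*; *-identityˡ; *-assoc)
  open import Data.Integer.Tactic.RingSolver using (solve-∀)
  open import Data.Product using (_,_)
  open import Relation.Binary.PropositionalEquality
  open ≡-Reasoning
  open Continuants
  open Recursions

  combination : (ℕ → ℕ) → ℤ → ℤ → ℕ → ℕ → ℤ
  combination u A B s x = A * cont u x (+ s) + B * cont u x (+ s - + 1)

  -- Every such combination solves the recursion with coefficients u x for x < s, by the
  -- left-end expansion of both continuants.
  combination-solves : ∀ u A B s lo → Solves (λ x → + u x) (combination u A B s) lo s
  combination-solves u A B s lo x _ x<s with m≤n⇒∃[o]m+o≡n x<s
  ... | d , refl = begin
    A * cont u x (+ suc (x ℕ.+ d)) + B * cont u x (+ (x ℕ.+ d))
      ≡⟨ cong₂ (λ a b → A * a + B * b) (cont-expandˡ u x _ (suc d) (+-suc x d)) (cont-expandˡ u x _ d refl) ⟩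
    A * (+ u x * C₁ (suc x) + C₁ (2+ x)) + B * (+ u x * C₀ (suc x) + C₀ (2+ x))
      ≡⟨ regroup A B (+ u x) (C₁ (suc x)) (C₁ (2+ x)) (C₀ (suc x)) (C₀ (2+ x)) ⟩
    + u x * (A * C₁ (suc x) + B * C₀ (suc x)) + (A * C₁ (2+ x) + B * C₀ (2+ x))
      ∎
    where
    C₁ C₀ : ℕ → ℤ
    C₁ y = cont u y (+ suc (x ℕ.+ d))
    C₀ y = cont u y (+ (x ℕ.+ d))
    regroup : ∀ A B a p q p′ q′ → A * (a * p + q) + B * (a * p′ + q′) ≡ a * (A * p + B * p′) + (A * q + B * q′)
    regroup = solve-∀

  -- At x = s + 1 the combination takes the value A, since 𝔠_{s+1,s} = 1 and 𝔠_{s+1,s-1} = 0.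
  combination-at-s+1 : ∀ u A B s → combination u A B s (suc s) ≡ A
  combination-at-s+1 u A B s = begin
    A * cont u (suc s) (+ s) + B * cont u (suc s) (+ s - + 1)
      ≡⟨ cong₂ (λ a b → A * a + B * b) (cont-empty u s) (cont-vanishing u (suc s) (+ s - + 1) (shift (+ s))) ⟩
    A * 1ℤ + B * 0ℤ
      ≡⟨ simplify A B ⟩
    A ∎
    where
    shift : ∀ a → (a - + 1) + + 2 ≡ 1ℤ + a
    shift = solve-∀
    simplify : ∀ A B → A * 1ℤ + B * 0ℤ ≡ A
    simplify = solve-∀

  -- At x = s ≥ 1 the combination takes the value u_s A + B, since 𝔠_{s,s} = u_s and 𝔠_{s,s-1} = 1.
  combination-at-s : ∀ u A B s → combination u A B (suc s) (suc s) ≡ + u (suc s) * A + B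
  combination-at-s u A B s = begin
    A * cont u (suc s) (+ suc s) + B * cont u (suc s) (+ s)
      ≡⟨ cong₂ (λ a b → A * a + B * b) (cont-expandˡ u (suc s) (suc s) 0 (+-identityʳ (suc s))) (cont-empty u s) ⟩
    A * (+ u (suc s) * cont u (2+ s) (+ suc s) + cont u (2+ (suc s)) (+ suc s)) + B * 1ℤ
      ≡⟨ cong₂ (λ a b → A * (+ u (suc s) * a + b) + B * 1ℤ)
               (cont-empty u (suc s)) (cont-vanishing u (2+ (suc s)) (+ suc s) (cong +_ (+-comm (suc s) 2))) ⟩
    A * (+ u (suc s) * 1ℤ + 0ℤ) + B * 1ℤ
      ≡⟨ simplify A B (+ u (suc s)) ⟩
    + u (suc s) * A + B ∎
    where
    simplify : ∀ A B a → A * (a * 1ℤ + 0ℤ) + B * 1ℤ ≡ a * A + B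
    simplify = solve-∀

  solution-by-continuants : ∀ (u : ℕ → ℕ) (f : ℕ → ℤ) s → 1 ≤ s →
    (∀ x → 1 ≤ x → x ≤ s → f x ≡ + u x * f (suc x) + f (2+ x)) →
    ∀ x → 1 ≤ x → x ≤ suc s → f x ≡ combination u (f (suc s)) (f (2+ s)) s x
  solution-by-continuants u f (suc s) _ f-solves =
    solution-unique (λ x → + u x) f (combination u A B (suc s)) 1 (suc s)
      (λ x 1≤x x<s → f-solves x 1≤x (<⇒≤ x<s)) (combination-solves u A B (suc s) 1)
      (trans (f-solves (suc s) (s≤s z≤n) ≤-refl) (sym (combination-at-s u A B s)))
      (sym (combination-at-s+1 u A B (suc s)))
    where
    A = f (2+ s)
    B = f (suc (2+ s))

  sign-square : ∀ n → (-1ℤ ^ n) * (-1ℤ ^ n) ≡ 1ℤ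
  sign-square zero    = refl
  sign-square (suc n) = trans (negate² (-1ℤ ^ n)) (sign-square n)
    where
    negate² : ∀ a → (-1ℤ * a) * (-1ℤ * a) ≡ a * a
    negate² = solve-∀

  -- The signed left continuants (-1)^i 𝔠_{1,i-2} solve the recursion with coefficients u_i for
  -- all i ≥ 1: this is the right-end expansion 𝔠_{1,i} = u_i 𝔠_{1,i-1} + 𝔠_{1,i-2}.
  signedLeft : (ℕ → ℕ) → ℕ → ℤ
  signedLeft u i = (-1ℤ ^ i) * cont u 1 (+ i - + 2)

  signedLeft-solves : ∀ u m → Solves (λ x → + u x) (signedLeft u) 1 m
  signedLeft-solves u m (suc d) _ _ = begin
    -1ℤ * τ * X
      ≡⟨ rearrange τ (+ u (suc d)) (cont u 1 (+ d)) X ⟩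
    + u (suc d) * (-1ℤ * (-1ℤ * τ) * cont u 1 (+ d)) + -1ℤ * (-1ℤ * (-1ℤ * τ)) * (+ u (suc d) * cont u 1 (+ d) + X)
      ≡⟨ cong (λ c → + u (suc d) * (-1ℤ * (-1ℤ * τ) * cont u 1 (+ d)) + -1ℤ * (-1ℤ * (-1ℤ * τ)) * c)
              (sym (cont-expandʳ u 1 d)) ⟩
    + u (suc d) * (-1ℤ * (-1ℤ * τ) * cont u 1 (+ d)) + -1ℤ * (-1ℤ * (-1ℤ * τ)) * cont u 1 (+ suc d)
      ∎
    where
    τ = -1ℤ ^ d
    X = cont u 1 (+ suc d - + 2)
    rearrange : ∀ τ a C X → -1ℤ * τ * X ≡ a * (-1ℤ * (-1ℤ * τ) * C) + -1ℤ * (-1ℤ * (-1ℤ * τ)) * (a * C + X)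
    rearrange = solve-∀

  -- The left continuants 𝔠_{1,i-2} in terms of 𝔠_{i,s}, 𝔠_{i,s-1}: both sides (suitably signed)
  -- solve the recursion, and they agree at i = s and i = s + 1.
  left-continuant-identity : ∀ u s → 1 ≤ s → ∀ i → 1 ≤ i → i ≤ suc s →
    cont u 1 (+ i - + 2) ≡ (-1ℤ ^ (i ℕ.+ s)) * (cont u 1 (+ s) * cont u i (+ s - + 1) - cont u 1 (+ s - + 1) * cont u i (+ s))
  left-continuant-identity u (suc s) _ i 1≤i i≤s+1 = begin
    cont u 1 (+ i - + 2)
      ≡⟨ unsign (-1ℤ ^ i) (cont u 1 (+ i - + 2)) (sign-square i) ⟩
    (-1ℤ ^ i) * signedLeft u i
      ≡⟨ cong ((-1ℤ ^ i) *_) signed≡combination ⟩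
    (-1ℤ ^ i) * combination u (σ * - B) (σ * A) (suc s) i
      ≡⟨ collect (-1ℤ ^ i) σ A B (cont u i (+ suc s)) (cont u i (+ s)) ⟩
    (-1ℤ ^ i) * σ * (A * cont u i (+ s) - B * cont u i (+ suc s))
      ≡⟨ cong (_* (A * cont u i (+ s) - B * cont u i (+ suc s))) (sym (^-distribˡ-+-* -1ℤ i (suc s))) ⟩
    (-1ℤ ^ (i ℕ.+ suc s)) * (A * cont u i (+ s) - B * cont u i (+ suc s))
      ∎
    where
    σ = -1ℤ ^ suc s
    A = cont u 1 (+ suc s)
    B = cont u 1 (+ s)
    X = cont u 1 (+ suc s - + 2)
    unsign : ∀ τ c → τ * τ ≡ 1ℤ → c ≡ τ * (τ * c)
    unsign τ c τ²≡1 = trans (sym (trans (cong (_* c) τ²≡1) (*-identityˡ c))) (*-assoc τ τ c)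
    collect : ∀ τ σ A B C C′ → τ * ((σ * - B) * C + (σ * A) * C′) ≡ τ * σ * (A * C′ - B * C)
    collect = solve-∀
    agree-s : signedLeft u (suc s) ≡ combination u (σ * - B) (σ * A) (suc s) (suc s)
    agree-s = begin
      σ * X
        ≡⟨ expand σ (+ u (suc s)) B X ⟩
      + u (suc s) * (σ * - B) + σ * (+ u (suc s) * B + X)
        ≡⟨ cong (λ a → + u (suc s) * (σ * - B) + σ * a) (sym (cont-expandʳ u 1 s)) ⟩
      + u (suc s) * (σ * - B) + σ * A
        ≡⟨ sym (combination-at-s u (σ * - B) (σ * A) s) ⟩
      combination u (σ * - B) (σ * A) (suc s) (suc s) ∎
      where
      expand : ∀ σ a B X → σ * X ≡ a * (σ * - B) + σ * (a * B + X)
      expand = solve-∀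
    agree-s+1 : signedLeft u (2+ s) ≡ combination u (σ * - B) (σ * A) (suc s) (2+ s)
    agree-s+1 = begin
      -1ℤ * σ * cont u 1 (+ 2+ s - + 2)     ≡⟨ cong (λ j → -1ℤ * σ * cont u 1 j) (shift (+ suc s)) ⟩
      -1ℤ * σ * B                           ≡⟨ flip σ B ⟩
      σ * - B                               ≡⟨ sym (combination-at-s+1 u (σ * - B) (σ * A) (suc s)) ⟩
      combination u (σ * - B) (σ * A) (suc s) (2+ s) ∎
      where
      shift : ∀ a → (1ℤ + a) - + 2 ≡ a - + 1
      shift = solve-∀
      flip : ∀ σ B → -1ℤ * σ * B ≡ σ * - B
      flip = solve-∀
    signed≡combination : signedLeft u i ≡ combination u (σ * - B) (σ * A) (suc s) i
    signed≡combination =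
      solution-unique (λ x → + u x) (signedLeft u) (combination u (σ * - B) (σ * A) (suc s)) 1 (suc s)
        (signedLeft-solves u (suc s)) (combination-solves u (σ * - B) (σ * A) (suc s) 1)
        agree-s agree-s+1 i 1≤i i≤s+1

module IndexArithmetic where

  open import Data.Nat as ℕ using (suc)
  open import Data.Integer using (+_; _+_; _-_; 1ℤ)
  open import Data.Integer.Tactic.RingSolver using (solve-∀)
  open import Relation.Binary.PropositionalEquality

  difference : ∀ {a b c} → a ℕ.+ b ≡ c → + c - + a ≡ + b
  difference {a} {b} refl = cancel (+ a) (+ b)
    where
    cancel : ∀ a b → (a + b) - a ≡ b
    cancel = solve-∀

  difference-offset : ∀ {x i c} → x ℕ.+ i ≡ c ℕ.+ 2 → + c - + x ≡ + i - + 2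
  difference-offset {x} {i} {c} x+i≡c+2 = begin
    + c - + x                    ≡⟨ addTwo (+ c) (+ x) ⟩
    (+ c + + 2) - + x - + 2      ≡⟨ cong (λ z → + z - + x - + 2) (sym x+i≡c+2) ⟩
    (+ x + + i) - + x - + 2      ≡⟨ cancel (+ x) (+ i) ⟩
    + i - + 2                    ∎
    where
    open ≡-Reasoning
    addTwo : ∀ c x → c - x ≡ (c + + 2) - x - + 2
    addTwo = solve-∀
    cancel : ∀ x i → (x + i) - x - + 2 ≡ i - + 2
    cancel = solve-∀

  difference-suc : ∀ c a {b} → + c - + a ≡ b → + c - + suc a ≡ b - + 1
  difference-suc c a refl = shift (+ c) (+ a)
    where
    shift : ∀ c a → c - (1ℤ + a) ≡ (c - a) - + 1
    shift = solve-∀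

module SymmetricEuclid where

  open import Defs
  open import Data.Nat using (ℕ; suc; _≤_; _∸_; _*_; _+_; s≤s; z≤n)
  open import Data.Integer using (+_; _-_; 0ℤ; 1ℤ) renaming (_+_ to _+ℤ_; _*_ to _*ℤ_)
  open import Data.Integer.Properties using (pos-*; +-inverseʳ)
  open import Data.Integer.Tactic.RingSolver using (solve-∀)
  open import Data.Nat.Properties
    using (+-comm; +-suc; ≤-refl; ≤-trans; ≤-pred; n≤1+n; m≤n⇒m≤1+n; m≤m+n; +-monoˡ-≤; +-monoʳ-≤; +-cancelˡ-≤;
           m≤n⇒∃[o]m+o≡n; m+n∸n≡m; m∸n+n≡m; m+n≤o⇒m≤o∸n; m+n≤o⇒n≤o; ∸-monoʳ-≤)
  open import Data.Nat.Tactic.RingSolver using () renaming (solve-∀ to ℕ-solve-∀)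
  open import Data.Product using (_,_)
  open import Relation.Binary.PropositionalEquality
  open ≡-Reasoning
  open Continuants
  open Recursions
  open ContinuantIdentities
  open IndexArithmetic

  module Remainders (s : ℕ) (q u r : ℕ → ℕ) (1≤s : 1 ≤ s)
    (u≡q : ∀ k → 1 ≤ k → k ≤ s → u k ≡ q k)
    (u≡q-reversed : ∀ k → 1 ≤ k → k ≤ s → u (2 * s + 1 ∸ k) ≡ q k)
    (r-last : r (2 * s + 2) ≡ 0) (r-one : r (2 * s + 1) ≡ 1)
    (r-step : ∀ k → 1 ≤ k → k ≤ 2 * s → r k ≡ u k * r (k + 1) + r (k + 2)) where

    remainder-recursion : ∀ x → 1 ≤ x → x ≤ 2 * s → + r x ≡ + u x *ℤ + r (suc x) +ℤ + r (suc (suc x))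
    remainder-recursion x 1≤x x≤2s = begin
      + r x                                  ≡⟨ cong +_ (r-step x 1≤x x≤2s) ⟩
      + (u x * r (x + 1) + r (x + 2))        ≡⟨ cong₂ _+ℤ_ (pos-* (u x) (r (x + 1))) refl ⟩
      + u x *ℤ + r (x + 1) +ℤ + r (x + 2)    ≡⟨ cong₂ (λ a b → + u x *ℤ + r a +ℤ + r b) (+-comm x 1) (+-comm x 2) ⟩
      + u x *ℤ + r (suc x) +ℤ + r (suc (suc x)) ∎

    middle-split : suc s + s ≡ 2 * s + 1
    middle-split = split s
      where
      split : ∀ s → suc s + s ≡ 2 * s + 1
      split = ℕ-solve-∀

    s+1≤2s+1 : suc s ≤ 2 * s + 1
    s+1≤2s+1 = subst (suc s ≤_) middle-split (m≤m+n (suc s) s)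

    remainders-tail : ∀ x → suc s ≤ x → x ≤ suc (2 * s + 1) → + r x ≡ cont q 1 (+ (2 * s + 1) - + x)
    remainders-tail =
      solution-unique (λ x → + u x) (λ x → + r x) (λ x → cont q 1 (+ (2 * s + 1) - + x)) (suc s) (2 * s + 1)
        r-solves left-solves agree-one agree-zero
      where
      r-solves : Solves (λ x → + u x) (λ x → + r x) (suc s) (2 * s + 1)
      r-solves x s<x x<2s+1 =
        remainder-recursion x (≤-trans (s≤s z≤n) s<x) (≤-pred (subst (suc x ≤_) (+-comm (2 * s) 1) x<2s+1))
      agree-one : + r (2 * s + 1) ≡ cont q 1 (+ (2 * s + 1) - + (2 * s + 1))
      agree-one = begin
        + r (2 * s + 1)                             ≡⟨ cong +_ r-one ⟩
        1ℤ                                          ≡⟨ sym (cont-empty q 0) ⟩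
        cont q 1 0ℤ                                 ≡⟨ cong (cont q 1) (sym (+-inverseʳ (+ (2 * s + 1)))) ⟩
        cont q 1 (+ (2 * s + 1) - + (2 * s + 1))    ∎
      agree-zero : + r (suc (2 * s + 1)) ≡ cont q 1 (+ (2 * s + 1) - + suc (2 * s + 1))
      agree-zero = begin
        + r (suc (2 * s + 1))                           ≡⟨ cong (λ x → + r x) (sym (+-suc (2 * s) 1)) ⟩
        + r (2 * s + 2)                                 ≡⟨ cong +_ r-last ⟩
        0ℤ
          ≡⟨ sym (cont-vanishing q 1 (+ (2 * s + 1) - + suc (2 * s + 1)) (beforeStart (+ (2 * s + 1)))) ⟩
        cont q 1 (+ (2 * s + 1) - + suc (2 * s + 1))    ∎
        where
        beforeStart : ∀ a → (a - (1ℤ +ℤ a)) +ℤ + 2 ≡ + 1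
        beforeStart = solve-∀
      -- Below 2s + 1 write x + k + 1 = 2s + 1; then u_x = q_{k+1} and the step is the right-end
      -- expansion of 𝔠_{1,k+1}.
      left-solves : Solves (λ x → + u x) (λ x → cont q 1 (+ (2 * s + 1) - + x)) (suc s) (2 * s + 1)
      left-solves x s<x x<2s+1 with m≤n⇒∃[o]m+o≡n x<2s+1
      ... | k , x+1+k≡2s+1 = begin
        cont q 1 (+ (2 * s + 1) - + x)
          ≡⟨ cong (cont q 1) distance ⟩
        cont q 1 (+ suc k)
          ≡⟨ cont-expandʳ q 1 k ⟩
        + q (suc k) *ℤ cont q 1 (+ k) +ℤ cont q 1 (+ suc k - + 2)
          ≡⟨ cong₂ (λ a j → + a *ℤ cont q 1 (+ k) +ℤ cont q 1 j) (sym u-x) (lower (+ k)) ⟩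
        + u x *ℤ cont q 1 (+ k) +ℤ cont q 1 ((+ suc k - + 1) - + 1)
          ≡⟨ cong₂ (λ j j′ → + u x *ℤ cont q 1 j +ℤ cont q 1 j′)
                   (sym distance′) (sym (difference-suc (2 * s + 1) (suc x) distance′)) ⟩
        + u x *ℤ cont q 1 (+ (2 * s + 1) - + suc x) +ℤ cont q 1 (+ (2 * s + 1) - + suc (suc x))
          ∎
        where
        x+k+1≡2s+1 : x + suc k ≡ 2 * s + 1
        x+k+1≡2s+1 = trans (+-suc x k) x+1+k≡2s+1
        distance : + (2 * s + 1) - + x ≡ + suc k
        distance = difference x+k+1≡2s+1
        distance′ : + (2 * s + 1) - + suc x ≡ + k
        distance′ = difference x+1+k≡2s+1
        lower : ∀ a → (1ℤ +ℤ a) - + 2 ≡ a - + 1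
        lower = solve-∀
        k<s : suc k ≤ s
        k<s = +-cancelˡ-≤ (suc s) (suc k) s bound
          where
          halves : ∀ s → 2 * s + 1 ≡ suc s + s
          halves = ℕ-solve-∀
          bound : suc s + suc k ≤ suc s + s
          bound = subst (suc s + suc k ≤_) (trans x+k+1≡2s+1 (halves s)) (+-monoˡ-≤ (suc k) s<x)
        u-x : u x ≡ q (suc k)
        u-x = trans (cong u (sym (trans (cong (_∸ suc k) (sym x+k+1≡2s+1)) (m+n∸n≡m x (suc k)))))
                    (u≡q-reversed (suc k) (s≤s z≤n) k<s)

    remainder-middle : + r (suc s) ≡ cont q 1 (+ s)
    remainder-middle = trans (remainders-tail (suc s) ≤-refl (m≤n⇒m≤1+n s+1≤2s+1))
                             (cong (cont q 1) (difference {suc s} {s} middle-split))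

    remainder-middle′ : + r (suc (suc s)) ≡ cont q 1 (+ s - + 1)
    remainder-middle′ = trans (remainders-tail (suc (suc s)) (n≤1+n (suc s)) (s≤s s+1≤2s+1))
                              (cong (cont q 1) (difference-suc (2 * s + 1) (suc s) (difference {suc s} {s} middle-split)))

    remainders-reversed : ∀ i → 1 ≤ i → i ≤ s + 1 → + r (2 * s + 3 ∸ i) ≡ cont q 1 (+ i - + 2)
    remainders-reversed i 1≤i i≤s+1 =
      trans (remainders-tail (2 * s + 3 ∸ i) s+1≤x x≤2s+2)
            (cong (cont q 1) (difference-offset {2 * s + 3 ∸ i} {i} x+i≡2s+1+2))
      where
      total₁ : ∀ s → 2 * s + 3 ≡ suc (suc s + (s + 1))
      total₁ = ℕ-solve-∀
      total₂ : ∀ s → 2 * s + 3 ≡ suc (suc (2 * s + 1))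
      total₂ = ℕ-solve-∀
      total₃ : ∀ s → 2 * s + 3 ≡ (2 * s + 1) + 2
      total₃ = ℕ-solve-∀
      s+1+i≤2s+3 : suc s + i ≤ 2 * s + 3
      s+1+i≤2s+3 = ≤-trans (+-monoʳ-≤ (suc s) i≤s+1) (subst (suc s + (s + 1) ≤_) (sym (total₁ s)) (n≤1+n _))
      s+1≤x : suc s ≤ 2 * s + 3 ∸ i
      s+1≤x = m+n≤o⇒m≤o∸n (suc s) s+1+i≤2s+3
      x≤2s+2 : 2 * s + 3 ∸ i ≤ suc (2 * s + 1)
      x≤2s+2 = subst (2 * s + 3 ∸ i ≤_) (cong (_∸ 1) (total₂ s)) (∸-monoʳ-≤ (2 * s + 3) 1≤i)
      x+i≡2s+1+2 : (2 * s + 3 ∸ i) + i ≡ (2 * s + 1) + 2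
      x+i≡2s+1+2 = trans (m∸n+n≡m (m+n≤o⇒n≤o (suc s) s+1+i≤2s+3)) (total₃ s)

    -- The first half of the remainders: r_i = 𝔠_{1,s} 𝔠_{i,s} + 𝔠_{1,s-1} 𝔠_{i,s-1} for 1 ≤ i ≤ s + 1,
    -- since the remainders solve the recursion with coefficients q_i there.
    remainders-head : ∀ i → 1 ≤ i → i ≤ s + 1 →
      + r i ≡ cont q 1 (+ s) *ℤ cont q i (+ s) +ℤ cont q 1 (+ s - + 1) *ℤ cont q i (+ s - + 1)
    remainders-head i 1≤i i≤s+1 = begin
      + r i
        ≡⟨ solution-by-continuants q (λ x → + r x) s 1≤s r-solves i 1≤i (subst (i ≤_) (+-comm s 1) i≤s+1) ⟩
      combination q (+ r (suc s)) (+ r (suc (suc s))) s i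
        ≡⟨ cong₂ (λ A B → A *ℤ cont q i (+ s) +ℤ B *ℤ cont q i (+ s - + 1)) remainder-middle remainder-middle′ ⟩
      cont q 1 (+ s) *ℤ cont q i (+ s) +ℤ cont q 1 (+ s - + 1) *ℤ cont q i (+ s - + 1)
        ∎
      where
      r-solves : ∀ x → 1 ≤ x → x ≤ s → + r x ≡ + q x *ℤ + r (suc x) +ℤ + r (suc (suc x))
      r-solves x 1≤x x≤s = trans (remainder-recursion x 1≤x (≤-trans x≤s (m≤m+n s (s + 0))))
                                 (cong (λ a → + a *ℤ + r (suc x) +ℤ + r (suc (suc x))) (u≡q x 1≤x x≤s))

open import Defs
open import Data.Nat using (ℕ; _≤_; _<_; _∸_; _*_; _+_)
open import Data.Nat.Coprimality using (Coprime)
open import Data.Integer using (+_; -1ℤ; _^_; _-_) renaming (_*_ to _*ℤ_; _+_ to _+ℤ_)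
open import Data.Product using (_×_; _,_)
open import Data.Nat.Properties using (+-comm)
open import Relation.Binary.PropositionalEquality using (_≡_; subst)

theorem1 : (n a s : ℕ) (q u r : ℕ → ℕ) →
    0 < n → 0 < a → Coprime n a → 1 ≤ s →
    (∀ k → 1 ≤ k → k ≤ s → 0 < q k) →
    (∀ k → 1 ≤ k → k ≤ s → u k ≡ q k) →
    (∀ k → 1 ≤ k → k ≤ s → u (2 * s + 1 ∸ k) ≡ q k) →
    r (2 * s + 2) ≡ 0 →
    r (2 * s + 1) ≡ 1 →
    (∀ k → 1 ≤ k → k ≤ 2 * s → r k ≡ u k * r (k + 1) + r (k + 2)) →
    r 1 ≡ n → r 2 ≡ a →
    ∀ i → 1 ≤ i → i ≤ s + 1 →
      (+ r i ≡ cont q 1 (+ s) *ℤ cont q i (+ s) +ℤ cont q 1 (+ s - + 1) *ℤ cont q i (+ s - + 1))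
      × (+ r (2 * s + 3 ∸ i) ≡ cont q 1 (+ i - + 2))
      × (cont q 1 (+ i - + 2) ≡ (-1ℤ ^ (i + s)) *ℤ (cont q 1 (+ s) *ℤ cont q i (+ s - + 1) - cont q 1 (+ s - + 1) *ℤ cont q i (+ s)))
theorem1 n a s q u r _ _ _ 1≤s _ u≡q u≡q-reversed r-last r-one r-step _ _ i 1≤i i≤s+1 =
    remainders-head i 1≤i i≤s+1
  , remainders-reversed i 1≤i i≤s+1
  , ContinuantIdentities.left-continuant-identity q s 1≤s i 1≤i (subst (i ≤_) (+-comm s 1) i≤s+1)
  where
  open SymmetricEuclid.Remainders s q u r 1≤s u≡q u≡q-reversed r-last r-one r-step
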